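{- For every integer $n$, $$\Big(\tfrac{(7n-10)(7n-9)}2+(8n-10)+(3n-4)\Big)^2=\Big(\tfrac{(7n-10)(7n-9)}2\Big)^2+(8n-10)^3+(3n-4)^3,$$ and the equality remains true when $3n-4$ is replaced by $5n-5$ on both sides. -}

module Defs where

open import Data.Integer using (ℤ; +_; _+_; _-_; _*_)
open import Data.Integer.DivMod using (_/ℕ_)

-- T n = (7n-10)(7n-9)/2, computed with integer division by 2
-- (exact, since the product of two consecutive integers is even).
T : ℤ → ℤ
T n = (((+ 7) * n - + 10) * ((+ 7) * n - + 9)) /ℕ 2

-- Writing m = 7n - 10, the number T n = m(m+1)/2 is an exact integer, so 2·T n = m(m+1).
-- Expanding, (T + a + b)² = T² + a³ + b³ is equivalent to 2T(a+b) + (a+b)² = a³ + b³, and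
-- with 2T replaced by the polynomial m(m+1) this becomes a polynomial identity in n for
-- both choices of b.
module Submission where

open import Defs
open import Data.Integer using (ℤ; +_; _+_; _-_; _*_; _^_; ∣_∣)
open import Data.Integer.DivMod using (_/ℕ_; _%ℕ_; a≡a%ℕn+[a/ℕn]*n; n%ℕd<d)
open import Data.Integer.Divisibility.Signed using (_∣_; divides)
open import Data.Integer.Properties using (abs-*; +-identityˡ)
open import Data.Integer.Solver using (module +-*-Solver)
open import Data.Integer.Tactic.RingSolver using (solve-∀)
import Data.Nat as ℕ
open import Data.Nat.DivMod using (m<n⇒m%n≡m; m*n%n≡0)
open import Data.Product using (_×_; _,_)
open import Relation.Binary.PropositionalEquality using (_≡_; refl; sym; trans; cong; subst; module ≡-Reasoning)

-- The remainder r = n %ℕ d equals (q - n /ℕ d) * d; as 0 ≤ r < d, it must vanish.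
[n/ℕd]*d≡n : ∀ {n} d .{{_ : ℕ.NonZero d}} → + d ∣ n → (n /ℕ d) * + d ≡ n
[n/ℕd]*d≡n {n} d (divides q n≡q*d) = begin
  t * + d       ≡⟨ sym (+-identityˡ _) ⟩
  + 0 + t * + d ≡⟨ cong (λ k → + k + t * + d) (sym r≡0) ⟩
  + r + t * + d ≡⟨ sym (a≡a%ℕn+[a/ℕn]*n n d) ⟩
  n             ∎
  where
  open ≡-Reasoning
  t = n /ℕ d
  r = n %ℕ d
  sub-cancel : ∀ x y → x ≡ (x + y) - y
  sub-cancel = solve-∀
  sub-distrib : ∀ x y z → x * z - y * z ≡ (x - y) * z
  sub-distrib = solve-∀
  r≡[q-t]*d : + r ≡ (q - t) * + d
  r≡[q-t]*d = begin
    + r                       ≡⟨ sub-cancel (+ r) (t * + d) ⟩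
    (+ r + t * + d) - t * + d ≡⟨ cong (_- t * + d) (trans (sym (a≡a%ℕn+[a/ℕn]*n n d)) n≡q*d) ⟩
    q * + d - t * + d         ≡⟨ sub-distrib q t (+ d) ⟩
    (q - t) * + d             ∎
  r≡0 : r ≡ 0
  r≡0 = begin
    r                       ≡⟨ sym (m<n⇒m%n≡m (n%ℕd<d n d)) ⟩
    r ℕ.% d                 ≡⟨ cong (ℕ._% d) (trans (cong ∣_∣ r≡[q-t]*d) (abs-* (q - t) (+ d))) ⟩
    (∣ q - t ∣ ℕ.* d) ℕ.% d ≡⟨ m*n%n≡0 ∣ q - t ∣ d ⟩
    0                       ∎

2∣m*[m+1] : ∀ m → + 2 ∣ m * (m + + 1)
2∣m*[m+1] m with m %ℕ 2 | n%ℕd<d m 2 | a≡a%ℕn+[a/ℕn]*n m 2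
... | 0 | _ | m≡2h = divides (h * (h * + 2 + + 1)) (trans (cong (λ k → k * (k + + 1)) m≡2h) (even h))
  where
  h = m /ℕ 2
  even : ∀ h → (+ 0 + h * + 2) * ((+ 0 + h * + 2) + + 1) ≡ (h * (h * + 2 + + 1)) * + 2
  even = solve-∀
... | 1 | _ | m≡2h+1 = divides ((h * + 2 + + 1) * (h + + 1)) (trans (cong (λ k → k * (k + + 1)) m≡2h+1) (odd h))
  where
  h = m /ℕ 2
  odd : ∀ h → (+ 1 + h * + 2) * ((+ 1 + h * + 2) + + 1) ≡ ((h * + 2 + + 1) * (h + + 1)) * + 2
  odd = solve-∀
... | ℕ.suc (ℕ.suc _) | ℕ.s≤s (ℕ.s≤s ()) | _

T*2≡[7n-10]*[7n-9] : ∀ n → T n * + 2 ≡ ((+ 7) * n - + 10) * ((+ 7) * n - + 9)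
T*2≡[7n-10]*[7n-9] n = [n/ℕd]*d≡n 2 (subst (λ k → + 2 ∣ m * k) (successor n) (2∣m*[m+1] m))
  where
  m = (+ 7) * n - + 10
  successor : ∀ n → ((+ 7) * n - + 10) + + 1 ≡ (+ 7) * n - + 9
  successor = solve-∀

[t+a+b]²≡t²+a³+b³ : ∀ t p a b → t * + 2 ≡ p → p * (a + b) + (a + b) * (a + b) ≡ a * a * a + b * b * b →
  (t + a + b) ^ 2 ≡ t ^ 2 + a ^ 3 + b ^ 3
[t+a+b]²≡t²+a³+b³ t p a b 2t≡p eq = begin
  (t + a + b) ^ 2                               ≡⟨ expand t a b ⟩
  t ^ 2 + (t * + 2 * (a + b) + (a + b) * (a + b)) ≡⟨ cong (λ s → t ^ 2 + (s * (a + b) + (a + b) * (a + b))) 2t≡p ⟩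
  t ^ 2 + (p * (a + b) + (a + b) * (a + b))       ≡⟨ cong (λ s → t ^ 2 + s) eq ⟩
  t ^ 2 + (a * a * a + b * b * b)                 ≡⟨ cubes t a b ⟩
  t ^ 2 + a ^ 3 + b ^ 3                           ∎
  where
  open ≡-Reasoning
  open +-*-Solver
  expand : ∀ t a b → (t + a + b) ^ 2 ≡ t ^ 2 + (t * + 2 * (a + b) + (a + b) * (a + b))
  expand = solve 3 (λ t a b → (t :+ a :+ b) :^ 2 := t :^ 2 :+ (t :* con (+ 2) :* (a :+ b) :+ (a :+ b) :* (a :+ b))) refl
  cubes : ∀ t a b → t ^ 2 + (a * a * a + b * b * b) ≡ t ^ 2 + a ^ 3 + b ^ 3
  cubes = solve 3 (λ t a b → t :^ 2 :+ (a :* a :* a :+ b :* b :* b) := t :^ 2 :+ a :^ 3 :+ b :^ 3) refl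

identity-3n-4 : ∀ n → let p = ((+ 7) * n - + 10) * ((+ 7) * n - + 9); a = (+ 8) * n - + 10; b = (+ 3) * n - + 4 in
  p * (a + b) + (a + b) * (a + b) ≡ a * a * a + b * b * b
identity-3n-4 = solve-∀

identity-5n-5 : ∀ n → let p = ((+ 7) * n - + 10) * ((+ 7) * n - + 9); a = (+ 8) * n - + 10; b = (+ 5) * n - + 5 in
  p * (a + b) + (a + b) * (a + b) ≡ a * a * a + b * b * b
identity-5n-5 = solve-∀

mainTheorem2 : (n : ℤ) →
    (((T n + ((+ 8) * n - + 10) + ((+ 3) * n - + 4)) ^ 2) ≡ (T n ^ 2) + (((+ 8) * n - + 10) ^ 3) + (((+ 3) * n - + 4) ^ 3))
    × (((T n + ((+ 8) * n - + 10) + ((+ 5) * n - + 5)) ^ 2) ≡ (T n ^ 2) + (((+ 8) * n - + 10) ^ 3) + (((+ 5) * n - + 5) ^ 3))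
mainTheorem2 n =
    [t+a+b]²≡t²+a³+b³ (T n) _ _ _ (T*2≡[7n-10]*[7n-9] n) (identity-3n-4 n)
  , [t+a+b]²≡t²+a³+b³ (T n) _ _ _ (T*2≡[7n-10]*[7n-9] n) (identity-5n-5 n)
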